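{- Let $r\geq 2$ and let $m,a$ be integers with $1<m\leq a$. Define $\mathcal{F}=(f_1,\ldots,f_{3r})$ by $f_1=1$, $f_2=a$, $f_k=f_{k-1}+a$ if $k$ is odd and $3\leq k\leq 2r+1$, $f_k=f_{k-1}+(m-1)(2a-1)-a$ if $k$ is even and $3<k<2r+1$, and $f_k=f_{k-1}+(m-1)(2a-1)$ if $2r+1<k\leq 3r$. Then $\mathcal{F}$ has pattern $(+++-\cdots-+)$, i.e., its prefix coin systems of lengths $1,2,3$ are orderly, its prefix coin systems of lengths $4,\ldots,3r-1$ are not orderly, and $\mathcal{F}$ itself is orderly.
   Context: A coin system is a tuple $(c_1,\ldots,c_n)$ of integers with $c_1=1<c_2<\cdots<c_n$; each coin value may be used any number of times. For a positive integer $v$, $opt(v)$ is the minimum number of coins summing to $v$, and $grd(v)$ is the number of coins used by the greedy algorithm (repeatedly take as many coins as possible of the largest coin value not exceeding the remaining amount). A coin system is orderly if $grd(v)=opt(v)$ for all $v>0$. The prefix coin system of length $i$ is $(c_1,\ldots,c_i)$; the pattern of a coin system is the string whose $i$-th symbol is $+$ if the prefix of length $i$ is orderly and $-$ otherwise. -}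

module Defs where

open import Data.Nat using (ℕ; zero; suc; _+_; _*_; _∸_; _≤_; _<_; _≤ᵇ_; _%_; _/_; _≡ᵇ_)
open import Data.Nat.DivMod
open import Data.Bool using (Bool; if_then_else_)
open import Data.List using (List; []; _∷_; reverse; map; upTo; length)
open import Data.Nat.ListAction using (sum)
open import Data.Product using (Σ; _×_)
open import Relation.Binary.PropositionalEquality using (_≡_)

-- A coin system is represented by the list (c₁, …, cₙ) of its coin values,
-- in increasing order.

greedyDesc : List ℕ → ℕ → ℕ
greedyDesc [] v = 0
greedyDesc (zero ∷ cs) v = greedyDesc cs v
greedyDesc (suc c ∷ cs) v = v / suc c + greedyDesc cs (v % suc c)

grd : List ℕ → ℕ → ℕ
grd cs v = greedyDesc (reverse cs) v

dot : List ℕ → List ℕ → ℕ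
dot [] _ = 0
dot (c ∷ cs) [] = 0
dot (c ∷ cs) (x ∷ xs) = c * x + dot cs xs

Rep : List ℕ → ℕ → ℕ → Set
Rep cs v k = Σ (List ℕ) λ xs → (length xs ≡ length cs) × (dot cs xs ≡ v) × (sum xs ≡ k)

IsOpt : List ℕ → ℕ → ℕ → Set
IsOpt cs v k = Rep cs v k × (∀ k' → Rep cs v k' → k ≤ k')

Orderly : List ℕ → Set
Orderly cs = ∀ v → 0 < v → IsOpt cs v (grd cs v)

fstep : ℕ → ℕ → ℕ → ℕ → ℕ → ℕ
fstep r m a k p =
  if k ≤ᵇ (2 * r + 1)
  then (if (k % 2) ≡ᵇ 1 then p + a else p + ((m ∸ 1) * (2 * a ∸ 1) ∸ a))
  else p + (m ∸ 1) * (2 * a ∸ 1)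

fval : ℕ → ℕ → ℕ → ℕ → ℕ
fval r m a zero = 0
fval r m a (suc zero) = 1
fval r m a (suc (suc zero)) = a
fval r m a (suc (suc (suc j))) = fstep r m a (3 + j) (fval r m a (suc (suc j)))

F : ℕ → ℕ → ℕ → List ℕ
F r m a = map (λ i → fval r m a (suc i)) (upTo (3 * r))

-- With d = 2a − 1 and M = (m − 1)d the coins of 𝓕 are 1, a + iM (i < r) and
-- 2a + jM (j ≤ 2r − 2). Any C-coin representation of v gives v = E·a + I·M + u
-- with I ≤ (r − 1)E and E/2 + u ≤ C, and after greedy removes its coin from v a
-- decomposition of this kind with smaller C remains: surplus multiples of M are
-- traded for copies of a, as 2a = d + 1. So greedy is optimal for 𝓕 and, with
-- r = 1, for the prefix (1, a, 2a); prefixes (1) and (1, a) are always orderly.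
-- A prefix of length 4 … 3r − 1 ending in a + iM loses at (a + iM) + a + (m − 1),
-- which is (2a + (i − 1)M) + (m − 1)·2a with m coins against m + 1 greedy ones;
-- one ending in 2a + jM loses at 2a + (j + 1)M, the sum of two coins a + AM,
-- while greedy needs three because M is not a coin.

module Submission where

open import Defs
open import Data.Bool using (true; false; T)
open import Data.Bool.Properties using (T-≡)
open import Data.Empty using (⊥-elim)
open import Data.List using ([]; _∷_; reverse; applyUpTo; applyDownFrom; replicate; zipWith; length; take)
open import Data.List.Membership.Propositional using (_∈_)
open import Data.List.Membership.Propositional.Properties using (∈-applyUpTo⁺)
open import Data.List.Properties using (reverse-applyUpTo; map-upTo; length-replicate; length-zipWith)
open import Data.List.Relation.Unary.All as All using (All)
open import Data.List.Relation.Unary.All.Properties using (applyUpTo⁺₁)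
open import Data.List.Relation.Unary.Any using (here; there)
open import Data.Nat
open import Data.Nat.DivMod
open import Data.Nat.Divisibility using (_∣_; divides; ∣-refl; ∣1⇒≡1; ∣m+n∣m⇒∣n)
open import Data.Nat.Induction using (<-rec)
open import Data.Nat.ListAction using (sum)
open import Data.Nat.Properties
open import Algebra.Properties.CommutativeSemigroup +-commutativeSemigroup
  using () renaming (interchange to +-interchange)
open import Data.Nat.Tactic.RingSolver using (solve)
open import Data.Product using (Σ-syntax; ∃; _×_; _,_; proj₁; proj₂)
open import Data.Sum using (_⊎_; inj₁; inj₂)
open import Function.Bundles using (Equivalence)
open import Relation.Binary.PropositionalEquality
open import Relation.Nullary using (¬_; yes; no)

greedy-zero : ∀ cs → greedyDesc cs 0 ≡ 0
greedy-zero []           = refl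
greedy-zero (zero ∷ cs)  = greedy-zero cs
greedy-zero (suc c ∷ cs) = greedy-zero cs

greedy-skip : ∀ c cs v → v < c → greedyDesc (c ∷ cs) v ≡ greedyDesc cs v
greedy-skip (suc c) cs v v<c
  rewrite m<n⇒m/n≡0 v<c | m<n⇒m%n≡m v<c = refl

greedy-take : ∀ c cs v → 0 < c → c ≤ v → greedyDesc (c ∷ cs) v ≡ suc (greedyDesc (c ∷ cs) (v ∸ c))
greedy-take (suc c) cs v _ c≤v
  rewrite m/n≡1+[m∸n]/n c≤v | m≤n⇒[n∸m]%m≡n%m c≤v = refl

greedy : (ℕ → ℕ) → ℕ → ℕ → ℕ
greedy g n = greedyDesc (applyDownFrom g n)

grd-applyUpTo : ∀ g n v → grd (applyUpTo g n) v ≡ greedy g n v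
grd-applyUpTo g n v = cong (λ cs → greedyDesc cs v) (reverse-applyUpTo g n)

Largest : (ℕ → ℕ) → ℕ → ℕ → ℕ → Set
Largest g n v k = k < n × g k ≤ v × (∀ l → k < l → l < n → v < g l)

greedy-skip-above : ∀ g k n v → k ≤ n → (∀ l → k ≤ l → l < n → v < g l) → greedy g n v ≡ greedy g k v
greedy-skip-above g k zero v z≤n _ = refl
greedy-skip-above g k (suc n) v k≤1+n above with k ≟ suc n
... | yes refl = refl
... | no k≢1+n = trans (greedy-skip (g n) (applyDownFrom g n) v (above n k≤n ≤-refl))
                       (greedy-skip-above g k n v k≤n (λ l k≤l l<n → above l k≤l (m<n⇒m<1+n l<n)))
  where k≤n = ≤-pred (≤∧≢⇒< k≤1+n k≢1+n)

greedy-largest : ∀ g n v k → 0 < g k → Largest g n v k → greedy g n v ≡ suc (greedy g n (v ∸ g k))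
greedy-largest g n v k gk>0 (k<n , gk≤v , above) = begin
  greedy g n v                 ≡⟨ greedy-skip-above g (suc k) n v k<n above ⟩
  greedy g (suc k) v           ≡⟨ greedy-take (g k) (applyDownFrom g k) v gk>0 gk≤v ⟩
  suc (greedy g (suc k) v′)    ≡⟨ cong suc (greedy-skip-above g (suc k) n v′ k<n above′) ⟨
  suc (greedy g n v′)          ∎
  where
  open ≡-Reasoning
  v′ = v ∸ g k
  above′ : ∀ l → suc k ≤ l → l < n → v′ < g l
  above′ l k<l l<n = ≤-<-trans (m∸n≤m v (g k)) (above l k<l l<n)

largest-exists : ∀ g n v → 0 < n → g 0 ≤ v → ∃ (Largest g n v)
largest-exists g (suc zero) v _ g0≤v = 0 , ≤-refl , g0≤v , λ l 0<l l<1 → ⊥-elim (<-irrefl refl (≤-trans l<1 0<l))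
largest-exists g (suc (suc n)) v _ g0≤v with g (suc n) ≤? v | largest-exists g (suc n) v (s≤s z≤n) g0≤v
... | yes g[1+n]≤v | _ = suc n , ≤-refl , g[1+n]≤v , λ l n<l l<2+n → ⊥-elim (<-irrefl refl (≤-trans l<2+n n<l))
... | no  g[1+n]≰v | k , k<1+n , gk≤v , above = k , m<n⇒m<1+n k<1+n , gk≤v , above′
  where
  above′ : ∀ l → k < l → l < suc (suc n) → v < g l
  above′ l k<l l<2+n with l ≟ suc n
  ... | yes refl   = ≰⇒> g[1+n]≰v
  ... | no  l≢1+n  = above l k<l (≤∧≢⇒< (≤-pred l<2+n) l≢1+n)

greedy-top : ∀ g k v → 0 < g k → g k ≤ v → greedy g (suc k) v ≡ suc (greedy g (suc k) (v ∸ g k))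
greedy-top g k v gk>0 gk≤v = greedy-largest g (suc k) v k gk>0 (≤-refl , gk≤v , λ l k<l l<1+k → ⊥-elim (<-irrefl refl (≤-trans l<1+k k<l)))

greedy-units : ∀ g n w → 0 < n → g 0 ≡ 1 → (∀ l → 0 < l → l < n → w < g l) → greedy g n w ≡ w
greedy-units g n zero    _   _    _     = greedy-zero (applyDownFrom g n)
greedy-units g n (suc w) 0<n g0≡1 above = begin
  greedy g n (suc w)              ≡⟨ greedy-largest g n (suc w) 0 (≤-reflexive (sym g0≡1)) largest ⟩
  suc (greedy g n (suc w ∸ g 0))  ≡⟨ cong (λ c → suc (greedy g n (suc w ∸ c))) g0≡1 ⟩
  suc (greedy g n w)              ≡⟨ cong suc (greedy-units g n w 0<n g0≡1 (λ l 0<l l<n → <-trans (n<1+n w) (above l 0<l l<n))) ⟩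
  suc w                           ∎
  where
  open ≡-Reasoning
  largest : Largest g n (suc w) 0
  largest = 0<n , subst (_≤ suc w) (sym g0≡1) (s≤s z≤n) , above

greedy-pos : ∀ g n v → 0 < n → g 0 ≡ 1 → (∀ k → k < n → 0 < g k) → 0 < v → 0 < greedy g n v
greedy-pos g n v 0<n g0≡1 g>0 0<v with largest-exists g n v 0<n (subst (_≤ v) (sym g0≡1) 0<v)
... | k , L = subst (0 <_) (sym (greedy-largest g n v k (g>0 k (proj₁ L)) L)) (s≤s z≤n)

greedy-non-coin : ∀ g n v → 0 < n → g 0 ≡ 1 → (∀ k → k < n → 0 < g k) → 0 < v →
                  (∀ k → k < n → g k ≢ v) → 2 ≤ greedy g n v
greedy-non-coin g n v 0<n g0≡1 g>0 0<v non-coin with largest-exists g n v 0<n (subst (_≤ v) (sym g0≡1) 0<v)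
... | k , L@(k<n , gk≤v , _) = subst (2 ≤_) (sym (greedy-largest g n v k (g>0 k k<n) L))
        (s≤s (greedy-pos g n (v ∸ g k) 0<n g0≡1 g>0 (m<n⇒0<n∸m gk<v)))
  where
  gk<v : g k < v
  gk<v = ≤∧≢⇒< gk≤v (non-coin k k<n)

dot-zipWith-+ : ∀ cs xs ys → length xs ≡ length cs → length ys ≡ length cs →
                dot cs (zipWith _+_ xs ys) ≡ dot cs xs + dot cs ys
dot-zipWith-+ []       []       []       _ _ = refl
dot-zipWith-+ (c ∷ cs) (x ∷ xs) (y ∷ ys) ∣xs∣ ∣ys∣ = begin
  c * (x + y) + dot cs (zipWith _+_ xs ys)      ≡⟨ cong₂ _+_ (*-distribˡ-+ c x y)
                                                     (dot-zipWith-+ cs xs ys (suc-injective ∣xs∣) (suc-injective ∣ys∣)) ⟩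
  (c * x + c * y) + (dot cs xs + dot cs ys)     ≡⟨ +-interchange (c * x) (c * y) (dot cs xs) (dot cs ys) ⟩
  (c * x + dot cs xs) + (c * y + dot cs ys)     ∎
  where open ≡-Reasoning

sum-zipWith-+ : ∀ xs ys → length xs ≡ length ys → sum (zipWith _+_ xs ys) ≡ sum xs + sum ys
sum-zipWith-+ []       []       _     = refl
sum-zipWith-+ (x ∷ xs) (y ∷ ys) ∣xs∣≡∣ys∣ =
  trans (cong (x + y +_) (sum-zipWith-+ xs ys (suc-injective ∣xs∣≡∣ys∣))) (+-interchange x y (sum xs) (sum ys))

rep-zero : ∀ cs → Rep cs 0 0
rep-zero cs = replicate (length cs) 0 , length-replicate (length cs) , dot-zeros cs , sum-zeros (length cs)
  where
  dot-zeros : ∀ cs → dot cs (replicate (length cs) 0) ≡ 0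
  dot-zeros []       = refl
  dot-zeros (c ∷ cs) = trans (cong (_+ dot cs (replicate (length cs) 0)) (*-zeroʳ c)) (dot-zeros cs)
  sum-zeros : ∀ n → sum (replicate n 0) ≡ 0
  sum-zeros zero    = refl
  sum-zeros (suc n) = sum-zeros n

rep-+ : ∀ cs {v v′ k k′} → Rep cs v k → Rep cs v′ k′ → Rep cs (v + v′) (k + k′)
rep-+ cs (xs , ∣xs∣ , xs·cs , Σxs) (ys , ∣ys∣ , ys·cs , Σys) =
  zipWith _+_ xs ys ,
  trans (length-zipWith _+_ xs ys) (trans (cong₂ _⊓_ ∣xs∣ ∣ys∣) (⊓-idem (length cs))) ,
  trans (dot-zipWith-+ cs xs ys ∣xs∣ ∣ys∣) (cong₂ _+_ xs·cs ys·cs) ,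
  trans (sum-zipWith-+ xs ys (trans ∣xs∣ (sym ∣ys∣))) (cong₂ _+_ Σxs Σys)

rep-coin : ∀ {cs c} → c ∈ cs → Rep cs c 1
rep-coin {c ∷ cs} (here refl) with rep-zero cs
... | xs , ∣xs∣ , xs·cs , Σxs = 1 ∷ xs , cong suc ∣xs∣ , trans (cong₂ _+_ (*-identityʳ c) xs·cs) (+-identityʳ c) , cong suc Σxs
rep-coin {c′ ∷ cs} (there c∈cs) with rep-coin c∈cs
... | xs , ∣xs∣ , xs·cs , Σxs = 0 ∷ xs , cong suc ∣xs∣ , trans (cong (_+ dot cs xs) (*-zeroʳ c′)) xs·cs , Σxs

rep-* : ∀ cs {c} x → Rep cs c 1 → Rep cs (x * c) x
rep-* cs zero    _   = rep-zero cs
rep-* cs (suc x) c₁ = rep-+ cs c₁ (rep-* cs x c₁)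

rep⇒invariant : (P : ℕ → Set) (Q : ℕ → ℕ → Set) → Q 0 0 →
                (∀ {v C v′ C′} → Q v C → Q v′ C′ → Q (v + v′) (C + C′)) →
                (∀ {c} x → P c → Q (c * x) x) →
                ∀ {cs v k} → All P cs → Rep cs v k → Q v k
rep⇒invariant P Q Q-zero Q-+ Q-coin {cs} Pcs (xs , ∣xs∣ , refl , refl) = go cs Pcs xs ∣xs∣
  where
  go : ∀ cs → All P cs → ∀ xs → length xs ≡ length cs → Q (dot cs xs) (sum xs)
  go []       All.[]         []       _     = Q-zero
  go (c ∷ cs) (Pc All.∷ Pcs) (x ∷ xs) ∣xs∣ = Q-+ (Q-coin x Pc) (go cs Pcs xs (suc-injective ∣xs∣))

not-orderly : ∀ {cs v K} → Rep cs v K → K < grd cs v → ¬ Orderly cs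
not-orderly {cs} {zero}  _   K<grd _ = <⇒≱ K<grd (≤-trans (≤-reflexive (greedy-zero (reverse cs))) z≤n)
not-orderly {cs} {suc v} rep K<grd orderly = <⇒≱ K<grd (proj₂ (orderly (suc v) (s≤s z≤n)) _ rep)

-- Q v C must hold for every C-coin representation of v; if removing the coin that
-- greedy picks turns Q v C into Q (v − coin) C′ with C′ < C, then by induction on v
-- greedy never needs more than C coins.
module GreedyCriterion
  (g : ℕ → ℕ) (n : ℕ) (0<n : 0 < n) (g0≡1 : g 0 ≡ 1) (g>0 : ∀ k → k < n → 0 < g k)
  (Q : ℕ → ℕ → Set) (rep⇒Q : ∀ {v C} → Rep (applyUpTo g n) v C → Q v C)
  (exchange : ∀ {v C k} → Q v C → Largest g n v k → Σ[ C′ ∈ ℕ ] C′ < C × Q (v ∸ g k) C′)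
  where

  private
    largest : ∀ v → ∃ (Largest g n (suc v))
    largest v = largest-exists g n (suc v) 0<n (subst (_≤ suc v) (sym g0≡1) (s≤s z≤n))

    greedy-step : ∀ v k → Largest g n (suc v) k → greedy g n (suc v) ≡ suc (greedy g n (suc v ∸ g k))
    greedy-step v k L = greedy-largest g n (suc v) k (g>0 k (proj₁ L)) L

    remove< : ∀ v k → Largest g n (suc v) k → suc v ∸ g k < suc v
    remove< v k L = ∸-monoʳ-< (g>0 k (proj₁ L)) (proj₁ (proj₂ L))

  greedy-minimal : ∀ v {C} → Q v C → greedy g n v ≤ C
  greedy-minimal = <-rec (λ v → ∀ {C} → Q v C → greedy g n v ≤ C) step
    where
    step : ∀ v → (∀ {w} → w < v → ∀ {C} → Q w C → greedy g n w ≤ C) → ∀ {C} → Q v C → greedy g n v ≤ C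
    step zero    _  _  = ≤-trans (≤-reflexive (greedy-zero (applyDownFrom g n))) z≤n
    step (suc v) ih {C} q with largest v
    ... | k , L with exchange q L
    ...   | C′ , C′<C , q′ = begin
      greedy g n (suc v)               ≡⟨ greedy-step v k L ⟩
      suc (greedy g n (suc v ∸ g k))   ≤⟨ s≤s (ih (remove< v k L) q′) ⟩
      suc C′                           ≤⟨ C′<C ⟩
      C                                ∎
      where open ≤-Reasoning

  greedy-rep : ∀ v → Rep (applyUpTo g n) v (greedy g n v)
  greedy-rep = <-rec (λ v → Rep (applyUpTo g n) v (greedy g n v)) step
    where
    step : ∀ v → (∀ {w} → w < v → Rep (applyUpTo g n) w (greedy g n w)) → Rep (applyUpTo g n) v (greedy g n v)
    step zero    _  rewrite greedy-zero (applyDownFrom g n) = rep-zero (applyUpTo g n)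
    step (suc v) ih with largest v
    ... | k , L rewrite greedy-step v k L =
      subst (λ w → Rep (applyUpTo g n) w (suc (greedy g n (suc v ∸ g k)))) (m+[n∸m]≡n (proj₁ (proj₂ L)))
        (rep-+ (applyUpTo g n) (rep-coin (∈-applyUpTo⁺ g (proj₁ L))) (ih (remove< v k L)))

  orderly : Orderly (applyUpTo g n)
  orderly v _ rewrite grd-applyUpTo g n v = greedy-rep v , λ C rep → greedy-minimal v (rep⇒Q rep)

orderly-[1] : Orderly (1 ∷ [])
orderly-[1] = GreedyCriterion.orderly (λ _ → 1) 1 (s≤s z≤n) refl (λ _ _ → s≤s z≤n) _≤_ rep⇒≤ exchange
  where
  rep⇒≤ : ∀ {v C} → Rep (1 ∷ []) v C → v ≤ C
  rep⇒≤ = rep⇒invariant (_≡ 1) _≤_ z≤n +-mono-≤ (λ { x refl → ≤-reflexive (+-identityʳ x) }) (refl All.∷ All.[])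
  exchange : ∀ {v C k} → v ≤ C → Largest (λ _ → 1) 1 v k → Σ[ C′ ∈ ℕ ] C′ < C × v ∸ 1 ≤ C′
  exchange {v} v≤C (_ , 1≤v , _) = v ∸ 1 , <-≤-trans (∸-monoʳ-< (s≤s z≤n) 1≤v) v≤C , ≤-refl

orderly-[1,c] : ∀ c → 0 < c → Orderly (1 ∷ c ∷ [])
orderly-[1,c] c 0<c = GreedyCriterion.orderly coin 2 (s≤s z≤n) refl (λ k _ → coin>0 k) Q rep⇒Q exchange
  where
  coin : ℕ → ℕ
  coin zero    = 1
  coin (suc _) = c
  coin>0 : ∀ k → 0 < coin k
  coin>0 zero    = s≤s z≤n
  coin>0 (suc _) = 0<c
  Q : ℕ → ℕ → Set
  Q v C = Σ[ E ∈ ℕ ] Σ[ u ∈ ℕ ] v ≡ E * c + u × E + u ≤ C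
  Q-+ : ∀ {v C v′ C′} → Q v C → Q v′ C′ → Q (v + v′) (C + C′)
  Q-+ (E , u , refl , cost) (E′ , u′ , refl , cost′) =
    E + E′ , u + u′ , solve (E ∷ c ∷ u ∷ E′ ∷ u′ ∷ []) , ≤-trans (≤-reflexive (+-interchange E E′ u u′)) (+-mono-≤ cost cost′)
  Q-coin : ∀ {x} n → x ≡ 1 ⊎ x ≡ c → Q (x * n) n
  Q-coin n (inj₁ refl) = 0 , n , +-identityʳ n , ≤-refl
  Q-coin n (inj₂ refl) = n , 0 , solve (c ∷ n ∷ []) , ≤-reflexive (+-identityʳ n)
  rep⇒Q : ∀ {v C} → Rep (1 ∷ c ∷ []) v C → Q v C
  rep⇒Q = rep⇒invariant (λ x → x ≡ 1 ⊎ x ≡ c) Q (0 , 0 , refl , z≤n) Q-+ Q-coin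
            (inj₁ refl All.∷ inj₂ refl All.∷ All.[])
  units : ∀ {w C} → w < C → Σ[ C′ ∈ ℕ ] C′ < C × Q w C′
  units {w} w<C = w , w<C , 0 , w , refl , ≤-refl
  exchange : ∀ {v C k} → Q v C → Largest coin 2 v k → Σ[ C′ ∈ ℕ ] C′ < C × Q (v ∸ coin k) C′
  exchange {v} (zero , u , refl , u≤C) (_ , ck≤v , _) = units (<-≤-trans (∸-monoʳ-< (coin>0 _) ck≤v) u≤C)
  exchange {k = zero} (suc E , u , refl , cost) (_ , _ , above) = ⊥-elim (<⇒≱ (above 1 (s≤s z≤n) ≤-refl) (≤-trans (m≤m+n c (E * c)) (m≤m+n _ u)))
  exchange {k = suc zero} (suc E , u , refl , cost) _ =
    E + u , cost , E , u , trans (cong (_∸ c) (+-assoc c (E * c) u)) (m+n∸m≡n c (E * c + u)) , ≤-refl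
  exchange {k = suc (suc _)} _ (s≤s (s≤s ()) , _)

module Remainder (a d : ℕ) (d+1≡2a : d + 1 ≡ 2 * a) {e u q w : ℕ} (eq : e * a + u ≡ q * d + w) where

  private
    *2a : ∀ x → x * (2 * a) ≡ x * d + x
    *2a x = trans (cong (x *_) (sym d+1≡2a)) (trans (*-distribˡ-+ x d 1) (cong (x * d +_) (*-identityʳ x)))

  e≡2q+s⇒w≡q+sa+u : ∀ {s} → e ≡ 2 * q + s → w ≡ q + s * a + u
  e≡2q+s⇒w≡q+sa+u {s} refl = +-cancelˡ-≡ (q * d) w (q + s * a + u) (begin
    q * d + w                      ≡⟨ eq ⟨
    (2 * q + s) * a + u            ≡⟨ solve (q ∷ s ∷ a ∷ u ∷ []) ⟩
    q * (2 * a) + (s * a + u)      ≡⟨ cong (_+ (s * a + u)) (*2a q) ⟩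
    q * d + q + (s * a + u)        ≡⟨ solve (q ∷ d ∷ s ∷ a ∷ u ∷ []) ⟩
    q * d + (q + s * a + u)        ∎)
    where open ≡-Reasoning

  2q<e⇒a≤w : 2 * q < e → a ≤ w
  2q<e⇒a≤w 2q<e with m≤n⇒∃[o]m+o≡n 2q<e
  ... | s , 2q+1+s≡e = begin
    a                  ≤⟨ m≤m+n a (s * a) ⟩
    suc s * a          ≤⟨ m≤n+m (suc s * a) q ⟩
    q + suc s * a      ≤⟨ m≤m+n (q + suc s * a) u ⟩
    q + suc s * a + u  ≡⟨ e≡2q+s⇒w≡q+sa+u (trans (sym 2q+1+s≡e) (sym (+-suc (2 * q) s))) ⟨
    w                  ∎
    where open ≤-Reasoning

  e≤2q⇒2w≤e+2u : e ≤ 2 * q → 2 * w ≤ e + 2 * u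
  e≤2q⇒2w≤e+2u e≤2q with m≤n⇒∃[o]m+o≡n e≤2q
  ... | s , e+s≡2q = begin
    2 * w              ≤⟨ m≤n+m (2 * w) (s * d) ⟩
    s * d + 2 * w      ≡⟨ +-cancelˡ-≡ (e * d) (e + 2 * u) (s * d + 2 * w) doubled ⟨
    e + 2 * u          ∎
    where
    open ≤-Reasoning
    doubled : e * d + (e + 2 * u) ≡ e * d + (s * d + 2 * w)
    doubled = begin-equality
      e * d + (e + 2 * u)        ≡⟨ solve (e ∷ d ∷ u ∷ []) ⟩
      e * d + e + 2 * u          ≡⟨ cong (_+ 2 * u) (*2a e) ⟨
      e * (2 * a) + 2 * u        ≡⟨ solve (e ∷ a ∷ u ∷ []) ⟩
      2 * (e * a + u)            ≡⟨ cong (2 *_) eq ⟩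
      2 * (q * d + w)            ≡⟨ solve (q ∷ d ∷ w ∷ []) ⟩
      (2 * q) * d + 2 * w        ≡⟨ cong (λ x → x * d + 2 * w) e+s≡2q ⟨
      (e + s) * d + 2 * w        ≡⟨ solve (e ∷ s ∷ d ∷ w ∷ []) ⟩
      e * d + (s * d + 2 * w)    ∎

module Decomposition (a d M : ℕ) (d+1≡2a : d + 1 ≡ 2 * a) (d∣M : d ∣ M) (a<M : a < M) where

  X : ℕ → ℕ
  X i = a + i * M

  Y : ℕ → ℕ
  Y i = 2 * a + i * M

  X+a≡Y : ∀ i → X i + a ≡ Y i
  X+a≡Y i = unfolded
    where
    unfolded : a + i * M + a ≡ 2 * a + i * M
    unfolded = solve (a ∷ i ∷ M ∷ [])

  Y+M≡Y : ∀ i → Y i + M ≡ Y (suc i)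
  Y+M≡Y i = unfolded
    where
    unfolded : 2 * a + i * M + M ≡ 2 * a + suc i * M
    unfolded = solve (a ∷ i ∷ M ∷ [])

  Y+[M∸a]≡X : ∀ i → Y i + (M ∸ a) ≡ X (suc i)
  Y+[M∸a]≡X i = begin
    2 * a + i * M + (M ∸ a)   ≡⟨ regroup (M ∸ a) ⟩
    a + i * M + (a + (M ∸ a)) ≡⟨ cong (a + i * M +_) (m+[n∸m]≡n (<⇒≤ a<M)) ⟩
    a + i * M + M             ≡⟨ solve (a ∷ i ∷ M ∷ []) ⟩
    a + suc i * M             ∎
    where
    open ≡-Reasoning
    regroup : ∀ x → 2 * a + i * M + x ≡ a + i * M + (a + x)
    regroup x = solve (a ∷ i ∷ M ∷ x ∷ [])

  X+X≡Y+M : ∀ A B J → A + B ≡ suc J → X A + X B ≡ Y J + M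
  X+X≡Y+M A B J A+B≡1+J = begin
    a + A * M + (a + B * M)   ≡⟨ solve (a ∷ A ∷ M ∷ B ∷ []) ⟩
    2 * a + (A + B) * M       ≡⟨ cong (λ x → 2 * a + x * M) A+B≡1+J ⟩
    2 * a + suc J * M         ≡⟨ solve (a ∷ J ∷ M ∷ []) ⟩
    2 * a + J * M + M         ∎
    where open ≡-Reasoning

  private
    0<a : 0 < a
    0<a = *-cancelˡ-< 2 0 a (subst (0 <_) d+1≡2a (subst (0 <_) (+-comm 1 d) (s≤s z≤n)))

    a≤ : ∀ e I u → a ≤ suc e * a + I * M + u
    a≤ e I u = ≤-trans (m≤m+n a (e * a)) (≤-trans (m≤m+n (suc e * a) (I * M)) (m≤m+n _ u))

    multiple-bound : ∀ {i w x I y} → w < M → i * M + w ≡ x + I * M + y → I ≤ i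
    multiple-bound {i} {w} {x} {I} {y} w<M eq with I ≤? i
    ... | yes I≤i = I≤i
    ... | no  I≰i = ⊥-elim (<-irrefl refl (begin-strict
          i * M + w            <⟨ +-monoʳ-< (i * M) w<M ⟩
          i * M + M            ≡⟨ +-comm (i * M) M ⟩
          suc i * M            ≤⟨ *-monoˡ-≤ M (≰⇒> I≰i) ⟩
          I * M                ≤⟨ m≤n+m (I * M) x ⟩
          x + I * M            ≤⟨ m≤m+n (x + I * M) y ⟩
          x + I * M + y        ≡⟨ eq ⟨
          i * M + w            ∎))
      where open ≤-Reasoning

    cancel-multiples : ∀ {i w e I u} → I ≤ i → i * M + w ≡ e * a + I * M + u → Σ[ q ∈ ℕ ] e * a + u ≡ q * d + w
    cancel-multiples {i} {w} {e} {I} {u} I≤i eq with m≤n⇒∃[o]m+o≡n I≤i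
    ... | j , refl = j * p , +-cancelˡ-≡ (I * M) (e * a + u) (j * p * d + w) (begin
      I * M + (e * a + u)          ≡⟨ solve (I ∷ M ∷ e ∷ a ∷ u ∷ []) ⟩
      e * a + I * M + u            ≡⟨ eq ⟨
      (I + j) * M + w              ≡⟨ solve (I ∷ j ∷ M ∷ w ∷ []) ⟩
      I * M + (j * M + w)          ≡⟨ cong (λ x → I * M + (j * x + w)) (_∣_.equality d∣M) ⟩
      I * M + (j * (p * d) + w)    ≡⟨ cong (λ x → I * M + (x + w)) (*-assoc j p d) ⟨
      I * M + (j * p * d + w)      ∎)
      where
      open ≡-Reasoning
      p = _∣_.quotient d∣M

  open Remainder a d d+1≡2a

  module _ (R : ℕ) where

    data Coin : ℕ → Set where
      unit  : Coin 1
      xcoin : ∀ {i} → i ≤ R → Coin (X i)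
      ycoin : ∀ {i} → i ≤ 2 * R → Coin (Y i)

    -- v = E·a + I·M + u, where each of the E copies of a costs half a coin and carries
    -- at most R multiples of M, and each of the u units costs a whole coin.
    Decomp : ℕ → ℕ → Set
    Decomp v C = Σ[ E ∈ ℕ ] Σ[ I ∈ ℕ ] Σ[ u ∈ ℕ ] v ≡ E * a + I * M + u × I ≤ R * E × E + 2 * u ≤ 2 * C

    decomp-zero : Decomp 0 0
    decomp-zero = 0 , 0 , 0 , refl , z≤n , z≤n

    decomp-+ : ∀ {v C v′ C′} → Decomp v C → Decomp v′ C′ → Decomp (v + v′) (C + C′)
    decomp-+ {C = C} {C′ = C′} (E , I , u , refl , I≤RE , cost) (E′ , I′ , u′ , refl , I′≤RE′ , cost′) =
      E + E′ , I + I′ , u + u′ ,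
      solve (E ∷ a ∷ I ∷ M ∷ u ∷ E′ ∷ I′ ∷ u′ ∷ []) ,
      subst (I + I′ ≤_) (sym (*-distribˡ-+ R E E′)) (+-mono-≤ I≤RE I′≤RE′) ,
      (begin
        E + E′ + 2 * (u + u′)          ≡⟨ solve (E ∷ u ∷ E′ ∷ u′ ∷ []) ⟩
        (E + 2 * u) + (E′ + 2 * u′)    ≤⟨ +-mono-≤ cost cost′ ⟩
        2 * C + 2 * C′                 ≡⟨ *-distribˡ-+ 2 C C′ ⟨
        2 * (C + C′)                   ∎)
      where open ≤-Reasoning

    decomp-coin : ∀ {c} x → Coin c → Decomp (c * x) x
    decomp-coin x unit = 0 , 0 , x , solve (x ∷ a ∷ M ∷ []) , z≤n , ≤-refl
    decomp-coin x (xcoin {i} i≤R) =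
      x , i * x , 0 , expand , *-monoˡ-≤ x i≤R , ≤-trans (≤-reflexive (+-identityʳ x)) (m≤n*m x 2)
      where
      expand : (a + i * M) * x ≡ x * a + i * x * M + 0
      expand = solve (a ∷ i ∷ M ∷ x ∷ [])
    decomp-coin x (ycoin {i} i≤2R) =
      2 * x , i * x , 0 , expand ,
      (begin
        i * x          ≤⟨ *-monoˡ-≤ x i≤2R ⟩
        (2 * R) * x    ≡⟨ solve (R ∷ x ∷ []) ⟩
        R * (2 * x)    ∎) ,
      ≤-reflexive (+-identityʳ (2 * x))
      where
      open ≤-Reasoning
      expand : (2 * a + i * M) * x ≡ 2 * x * a + i * x * M + 0
      expand = solve (a ∷ i ∷ M ∷ x ∷ [])

    rep⇒decomp : ∀ {cs v C} → All Coin cs → Rep cs v C → Decomp v C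
    rep⇒decomp = rep⇒invariant Coin Decomp decomp-zero (λ {_} {C} {_} {C′} → decomp-+ {C = C} {C′ = C′}) decomp-coin

    Decomp< : ℕ → ℕ → Set
    Decomp< w C = Σ[ C′ ∈ ℕ ] C′ < C × Decomp w C′

    decomp< : ∀ {w C} E I u → w ≡ E * a + I * M + u → I ≤ R * E → 2 + (E + 2 * u) ≤ 2 * C → Decomp< w C
    decomp< {C = suc C} E I u eq I≤RE cost =
      C , ≤-refl , E , I , u , eq , I≤RE , ≤-pred (≤-pred (≤-trans cost (≤-reflexive (*-suc 2 C))))

    units< : ∀ {w C} → w < C → Decomp< w C
    units< {w} w<C = decomp< 0 0 w refl z≤n (≤-trans (≤-reflexive (sym (*-suc 2 w))) (*-monoʳ-≤ 2 w<C))

    units<-of-cost : ∀ {w C} E u → w < u → E + 2 * u ≤ 2 * C → Decomp< w C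
    units<-of-cost {w} {C} E u w<u cost = units< (*-cancelˡ-< 2 w C (begin-strict
      2 * w        <⟨ *-monoʳ-< 2 w<u ⟩
      2 * u        ≤⟨ m≤n+m (2 * u) E ⟩
      E + 2 * u    ≤⟨ cost ⟩
      2 * C        ∎))
      where open ≤-Reasoning

    private
      I≤R*0⇒I≡0 : ∀ {I} → I ≤ R * 0 → I ≡ 0
      I≤R*0⇒I≡0 {I} I≤R*0 = n≤0⇒n≡0 (subst (I ≤_) (*-zeroʳ R) I≤R*0)

    exchange-unit : ∀ {w C} → Decomp (1 + w) C → 1 + w < a → Decomp< w C
    exchange-unit (zero , I , u , eq , I≤R*0 , cost) _ with I≤R*0⇒I≡0 I≤R*0
    ... | refl = units<-of-cost 0 u (≤-reflexive eq) cost
    exchange-unit (suc e , I , u , eq , _ , _) 1+w<a = ⊥-elim (<⇒≱ 1+w<a (subst (a ≤_) (sym eq) (a≤ e I u)))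

    exchange-x : ∀ {w C} i → Decomp (X i + w) C → w < a → Decomp< w C
    exchange-x {w} i (zero , I , u , eq , I≤R*0 , cost) _ with I≤R*0⇒I≡0 I≤R*0
    ... | refl = units<-of-cost 0 u (subst (w <_) eq (m<n+m w (≤-trans 0<a (m≤m+n a (i * M))))) cost
    exchange-x {w} {C} i (suc e , I , u , eq , I≤RE , cost) w<a with cancel-multiples {e = e} {u = u} I≤i eq′
      where
      eq′ : i * M + w ≡ e * a + I * M + u
      eq′ = +-cancelˡ-≡ a _ _ (trans (sym (+-assoc a (i * M) w)) (trans eq (solve (e ∷ a ∷ I ∷ M ∷ u ∷ []))))
      I≤i : I ≤ i
      I≤i = multiple-bound {x = e * a} {y = u} (<-trans w<a a<M) eq′
    ... | q , eq″ with e ≤? 2 * q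
    ...   | no  e≰2q = ⊥-elim (<⇒≱ w<a (2q<e⇒a≤w {e} {u} {q} {w} eq″ (≰⇒> e≰2q)))
    ...   | yes e≤2q = units< (*-cancelˡ-< 2 w C (begin-strict
      2 * w            ≤⟨ e≤2q⇒2w≤e+2u {e} {u} {q} {w} eq″ e≤2q ⟩
      e + 2 * u        <⟨ n<1+n _ ⟩
      suc e + 2 * u    ≤⟨ cost ⟩
      2 * C            ∎))
      where open ≤-Reasoning

    private
      y-above : ∀ {w C} i e t u → w ≡ e * a + t * M + u → i + t ≤ R * (2 + e) → 2 + (e + 2 * u) ≤ 2 * C →
                i ≡ 2 * R ⊎ w < M → Decomp< w C
      y-above {w} i e t u weq I≤RE cost i≡2R⊎w<M = decomp< e t u weq (t≤Re i≡2R⊎w<M) cost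
        where
        t≤Re : i ≡ 2 * R ⊎ w < M → t ≤ R * e
        t≤Re (inj₁ refl) = +-cancelˡ-≤ (2 * R) t (R * e) (≤-trans I≤RE (≤-reflexive (solve (R ∷ e ∷ []))))
        t≤Re (inj₂ w<M)  = ≤-trans (≤-reflexive (n<1⇒n≡0 (*-cancelʳ-< M t 1 (begin-strict
          t * M               ≤⟨ m≤n+m (t * M) (e * a) ⟩
          e * a + t * M       ≤⟨ m≤m+n _ u ⟩
          e * a + t * M + u   ≡⟨ weq ⟨
          w                   <⟨ w<M ⟩
          M                   ≡⟨ +-identityʳ M ⟨
          1 * M               ∎)))) z≤n
          where open ≤-Reasoning

      -- The i − I surplus multiples of M are q copies of d, and since 2a = d + 1,
      -- 2q copies of a are worth q copies of d and q units.
      y-below : ∀ {w C} i e I u → I ≤ i → i * M + w ≡ e * a + I * M + u → 2 + (e + 2 * u) ≤ 2 * C → Decomp< w C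
      y-below {w} {C} i e I u I≤i eq cost with cancel-multiples {e = e} {u = u} I≤i eq
      ... | q , eq′ with 2 * q ≤? e
      ...   | no  2q≰e = units< (*-cancelˡ-≤ 2 (begin
        2 * suc w                ≡⟨ *-suc 2 w ⟩
        2 + 2 * w                ≤⟨ +-monoʳ-≤ 2 (e≤2q⇒2w≤e+2u {e} {u} {q} {w} eq′ (<⇒≤ (≰⇒> 2q≰e))) ⟩
        2 + (e + 2 * u)          ≤⟨ cost ⟩
        2 * C                    ∎))
        where open ≤-Reasoning
      ...   | yes 2q≤e with m≤n⇒∃[o]m+o≡n 2q≤e
      ...     | s , 2q+s≡e = decomp< s 0 (u + q) weq z≤n (begin
        2 + (s + 2 * (u + q))    ≡⟨ solve (s ∷ u ∷ q ∷ []) ⟩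
        2 + (2 * q + s) + 2 * u  ≡⟨ cong (λ x → 2 + x + 2 * u) 2q+s≡e ⟩
        2 + e + 2 * u            ≤⟨ cost ⟩
        2 * C                    ∎)
        where
        open ≤-Reasoning
        weq : w ≡ s * a + 0 * M + (u + q)
        weq = trans (e≡2q+s⇒w≡q+sa+u {e} {u} {q} {w} eq′ (sym 2q+s≡e)) (solve (q ∷ s ∷ a ∷ u ∷ M ∷ []))

    exchange-y : ∀ {w C} i → Decomp (Y i + w) C → i ≡ 2 * R ⊎ w < M → R ≤ i ⊎ w + a < M → Decomp< w C
    exchange-y {w} i (zero , I , u , eq , I≤R*0 , cost) _ _ with I≤R*0⇒I≡0 I≤R*0
    ... | refl = units<-of-cost 0 u (subst (w <_) eq (m<n+m w (≤-trans 0<a (≤-trans (m≤n*m a 2) (m≤m+n (2 * a) (i * M)))))) cost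
    exchange-y {w} i (suc zero , I , u , eq , I≤R*1 , cost) _ R≤i⊎w+a<M =
      units<-of-cost 1 u (<-≤-trans (m<m+n w 0<a) (w+a≤u (I≤i R≤i⊎w+a<M))) cost
      where
      eq′ : i * M + (w + a) ≡ I * M + u
      eq′ = +-cancelˡ-≡ a _ _ (begin
        a + (i * M + (w + a))   ≡⟨ solve (a ∷ i ∷ M ∷ w ∷ []) ⟩
        2 * a + i * M + w       ≡⟨ eq ⟩
        1 * a + I * M + u       ≡⟨ solve (a ∷ I ∷ M ∷ u ∷ []) ⟩
        a + (I * M + u)         ∎)
        where open ≡-Reasoning
      I≤i : R ≤ i ⊎ w + a < M → I ≤ i
      I≤i (inj₁ R≤i)   = ≤-trans I≤R*1 (≤-trans (≤-reflexive (*-identityʳ R)) R≤i)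
      I≤i (inj₂ w+a<M) = multiple-bound {x = 0} {y = u} w+a<M eq′
      w+a≤u : I ≤ i → w + a ≤ u
      w+a≤u I≤i = +-cancelˡ-≤ (I * M) _ _ (begin
        I * M + (w + a)   ≤⟨ +-monoˡ-≤ (w + a) (*-monoˡ-≤ M I≤i) ⟩
        i * M + (w + a)   ≡⟨ eq′ ⟩
        I * M + u         ∎)
        where open ≤-Reasoning
    exchange-y {w} i (suc (suc e) , I , u , eq , I≤RE , cost) i≡2R⊎w<M _ with i ≤? I
    ... | no  i≰I = y-below i e I u (<⇒≤ (≰⇒> i≰I)) eq′ cost
      where
      eq′ : i * M + w ≡ e * a + I * M + u
      eq′ = +-cancelˡ-≡ (2 * a) _ _ (trans (sym (+-assoc (2 * a) (i * M) w)) (trans eq (solve (e ∷ a ∷ I ∷ M ∷ u ∷ []))))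
    ... | yes i≤I with m≤n⇒∃[o]m+o≡n i≤I
    ...   | t , refl = y-above i e t u weq I≤RE cost i≡2R⊎w<M
      where
      weq : w ≡ e * a + t * M + u
      weq = +-cancelˡ-≡ (2 * a + i * M) _ _ (begin
        2 * a + i * M + w                   ≡⟨ eq ⟩
        suc (suc e) * a + (i + t) * M + u   ≡⟨ solve (e ∷ a ∷ i ∷ t ∷ M ∷ u ∷ []) ⟩
        2 * a + i * M + (e * a + t * M + u) ∎)
        where open ≡-Reasoning

take-applyUpTo : ∀ {A : Set} (f : ℕ → A) {i n} → i ≤ n → take i (applyUpTo f n) ≡ applyUpTo f i
take-applyUpTo f {zero}          _         = refl
take-applyUpTo f {suc i} {suc n} (s≤s i≤n) = cong (f 0 ∷_) (take-applyUpTo (λ k → f (suc k)) i≤n)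

≤ᵇ-false : ∀ {m n} → n < m → (m ≤ᵇ n) ≡ false
≤ᵇ-false {m} {n} n<m with m ≤ᵇ n in m≤ᵇn
... | false = refl
... | true  = ⊥-elim (<⇒≱ n<m (≤ᵇ⇒≤ m n (subst T (sym m≤ᵇn) _)))

≤ᵇ-true : ∀ {m n} → m ≤ n → (m ≤ᵇ n) ≡ true
≤ᵇ-true m≤n = Equivalence.to T-≡ (≤⇒≤ᵇ m≤n)

[b+[i+i]]%2≡b%2 : ∀ b i → (b + (i + i)) % 2 ≡ b % 2
[b+[i+i]]%2≡b%2 b i = trans (cong (λ j → (b + j) % 2) (solve (i ∷ []))) ([m+kn]%n≡m%n b i 2)

data Position (R : ℕ) : ℕ → Set where
  first : Position R 0
  x-pos : ∀ i → i ≤ R → Position R (1 + (i + i))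
  y-pos : ∀ i → i < R → Position R (2 + (i + i))
  tail  : ∀ t → Position R (2 + (R + R + t))

position : ∀ R k → Position R k
position R zero = first
position R (suc k) with position R k
... | first = x-pos 0 z≤n
... | x-pos i i≤R with m≤n⇒m<n∨m≡n i≤R
...   | inj₁ i<R  = y-pos i i<R
...   | inj₂ refl = subst (Position R) (cong (2 +_) (+-identityʳ (R + R))) (tail 0)
position R (suc k) | y-pos i i<R = subst (Position R) (cong (2 +_) (+-suc i i)) (x-pos (suc i) i<R)
position R (suc k) | tail t      = subst (Position R) (cong (2 +_) (+-suc (R + R) t)) (tail (suc t))

module Sequence (m a : ℕ) (1<m : 1 < m) (m≤a : m ≤ a) where

  p d M : ℕ
  p = m ∸ 1
  d = 2 * a ∸ 1
  M = p * d

  2≤a : 2 ≤ a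
  2≤a = ≤-trans 1<m m≤a

  d+1≡2a : d + 1 ≡ 2 * a
  d+1≡2a = m∸n+n≡m (≤-trans (s≤s z≤n) (*-monoʳ-≤ 2 2≤a))

  1≤p : 1 ≤ p
  1≤p = ∸-monoˡ-≤ 1 1<m

  p<a : p < a
  p<a = <-≤-trans (∸-monoʳ-< {m} {1} {0} (s≤s z≤n) (<⇒≤ 1<m)) m≤a

  a<d : a < d
  a<d = +-cancelʳ-≤ 1 (suc a) d (begin
    suc a + 1   ≡⟨ solve (a ∷ []) ⟩
    a + 2       ≤⟨ +-monoʳ-≤ a 2≤a ⟩
    a + a       ≡⟨ solve (a ∷ []) ⟩
    2 * a       ≡⟨ d+1≡2a ⟨
    d + 1       ∎)
    where open ≤-Reasoning

  a<M : a < M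
  a<M = <-≤-trans a<d (m≤n*m d p ⦃ >-nonZero 1≤p ⦄)

  d∣M : d ∣ M
  d∣M = divides p refl

  open Decomposition a d M d+1≡2a d∣M a<M public

  M≢2a : M ≢ 2 * a
  M≢2a M≡2a = <⇒≢ (<-trans 2≤a a<d) (sym (∣1⇒≡1 (∣m+n∣m⇒∣n d∣d+1 ∣-refl)))
    where
    d∣d+1 : d ∣ d + 1
    d∣d+1 = divides p (trans d+1≡2a (sym M≡2a))

  Y+pY₀≡X+a+p : ∀ j → Y j + p * Y 0 ≡ X (suc j) + (a + p)
  Y+pY₀≡X+a+p j = expand a j p d d+1≡2a
    where
    -- Quantified over a, j, p, d because the ring solver only accepts variables.
    expand : ∀ a j p d → d + 1 ≡ 2 * a → 2 * a + j * (p * d) + p * (2 * a + 0 * (p * d)) ≡ a + suc j * (p * d) + (a + p)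
    expand a j p d d+1≡2a = begin
      2 * a + j * (p * d) + p * (2 * a + 0 * (p * d))   ≡⟨ cong (λ x → 2 * a + j * (p * d) + p * (x + 0 * (p * d))) d+1≡2a ⟨
      2 * a + j * (p * d) + p * (d + 1 + 0 * (p * d))   ≡⟨ solve (a ∷ j ∷ p ∷ d ∷ []) ⟩
      a + suc j * (p * d) + (a + p)                     ∎
      where open ≡-Reasoning

  module _ (R : ℕ) where

    g : ℕ → ℕ
    g k = fval (suc R) m a (suc k)

    private
      last-odd : 2 * suc R + 1 ≡ 3 + (R + R)
      last-odd = solve (R ∷ [])

      fstep-odd : ∀ i x → i ≤ R → fstep (suc R) m a (3 + (i + i)) x ≡ x + a
      fstep-odd i x i≤R
        rewrite ≤ᵇ-true (subst (3 + (i + i) ≤_) (sym last-odd) (+-monoʳ-≤ 3 (+-mono-≤ i≤R i≤R)))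
              | [b+[i+i]]%2≡b%2 3 i = refl

      fstep-even : ∀ i x → suc i ≤ R → fstep (suc R) m a (4 + (i + i)) x ≡ x + (M ∸ a)
      fstep-even i x i<R
        rewrite ≤ᵇ-true (subst (4 + (i + i) ≤_) (sym last-odd) (+-monoʳ-≤ 3 (+-mono-≤ i<R (<⇒≤ i<R))))
              | [b+[i+i]]%2≡b%2 4 i = refl

      fstep-late : ∀ k x → 2 * suc R + 1 < k → fstep (suc R) m a k x ≡ x + M
      fstep-late k x late rewrite ≤ᵇ-false late = refl

      fstep-increasing : ∀ k x → x < fstep (suc R) m a k x
      fstep-increasing k x with k ≤ᵇ (2 * suc R + 1) | k % 2 ≡ᵇ 1
      ... | true  | true  = m<m+n x (≤-trans (s≤s z≤n) 2≤a)
      ... | true  | false = m<m+n x (m<n⇒0<n∸m a<M)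
      ... | false | _     = m<m+n x (≤-<-trans z≤n a<M)

    g-step-odd : ∀ i → i ≤ R → g (2 + (i + i)) ≡ g (1 + (i + i)) + a
    g-step-odd i = fstep-odd i _

    g-step-even : ∀ i → suc i ≤ R → g (3 + (i + i)) ≡ g (2 + (i + i)) + (M ∸ a)
    g-step-even i = fstep-even i _

    g-step-late : ∀ t → g (3 + (R + R + t)) ≡ g (2 + (R + R + t)) + M
    g-step-late t = fstep-late _ _ (subst (_< 4 + (R + R + t)) (sym last-odd) (+-monoʳ-< 3 (s≤s (m≤m+n (R + R) t))))

    g-x : ∀ i → i ≤ R → g (1 + (i + i)) ≡ X i
    g-y : ∀ i → i ≤ R → g (2 + (i + i)) ≡ Y i

    g-x zero    _     = sym (+-identityʳ a)
    g-x (suc i) 1+i≤R = begin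
      g (1 + (suc i + suc i))            ≡⟨ cong (λ j → g (2 + j)) (+-suc i i) ⟩
      g (3 + (i + i))                    ≡⟨ g-step-even i 1+i≤R ⟩
      g (2 + (i + i)) + (M ∸ a)          ≡⟨ cong (_+ (M ∸ a)) (g-y i (<⇒≤ 1+i≤R)) ⟩
      Y i + (M ∸ a)                      ≡⟨ Y+[M∸a]≡X i ⟩
      X (suc i)                          ∎
      where open ≡-Reasoning
    g-y i i≤R = trans (g-step-odd i i≤R) (trans (cong (_+ a) (g-x i i≤R)) (X+a≡Y i))

    g-tail : ∀ t → g (2 + (R + R + t)) ≡ Y (R + t)
    g-tail zero    = begin
      g (2 + (R + R + 0))         ≡⟨ cong (λ j → g (2 + j)) (+-identityʳ (R + R)) ⟩
      g (2 + (R + R))             ≡⟨ g-y R ≤-refl ⟩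
      Y R                         ≡⟨ cong Y (+-identityʳ R) ⟨
      Y (R + 0)                   ∎
      where open ≡-Reasoning
    g-tail (suc t) = begin
      g (2 + (R + R + suc t))     ≡⟨ cong (λ j → g (2 + j)) (+-suc (R + R) t) ⟩
      g (3 + (R + R + t))         ≡⟨ g-step-late t ⟩
      g (2 + (R + R + t)) + M     ≡⟨ cong (_+ M) (g-tail t) ⟩
      Y (R + t) + M               ≡⟨ Y+M≡Y (R + t) ⟩
      Y (suc (R + t))             ≡⟨ cong Y (+-suc R t) ⟨
      Y (R + suc t)               ∎
      where open ≡-Reasoning

    g-increasing : ∀ k → g k < g (suc k)
    g-increasing zero    = 2≤a
    g-increasing (suc k) = fstep-increasing (3 + k) (g (suc k))

    g-mono-< : ∀ {k l} → k < l → g k < g l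
    g-mono-< {k} {suc l} k<1+l with m≤n⇒m<n∨m≡n (≤-pred k<1+l)
    ... | inj₁ k<l  = <-trans (g-mono-< k<l) (g-increasing l)
    ... | inj₂ refl = g-increasing k

    g-mono-≤ : ∀ {k l} → k ≤ l → g k ≤ g l
    g-mono-≤ k≤l with m≤n⇒m<n∨m≡n k≤l
    ... | inj₁ k<l  = <⇒≤ (g-mono-< k<l)
    ... | inj₂ refl = ≤-refl

    g>0 : ∀ k → 0 < g k
    g>0 zero    = s≤s z≤n
    g>0 (suc k) = <-trans (g>0 k) (g-increasing k)

    private
      3[1+R]≡ : 3 * suc R ≡ 3 + (R + R + R)
      3[1+R]≡ = solve (R ∷ [])

      <3[1+R] : ∀ {j} → j ≤ 2 + (R + R + R) → j < 3 * suc R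
      <3[1+R] {j} j≤ = subst (j <_) (sym 3[1+R]≡) (s≤s j≤)

      tail-bound : ∀ t → 2 + (R + R + t) < 3 * suc R → t ≤ R
      tail-bound t bound = +-cancelˡ-≤ (R + R) t R (≤-pred (≤-pred (≤-pred (subst (2 + (R + R + t) <_) 3[1+R]≡ bound))))

    g-coin : ∀ k → k < 3 * suc R → Coin R (g k)
    g-coin k k<n with position R k
    ... | first       = unit
    ... | x-pos i i≤R = subst (Coin R) (sym (g-x i i≤R)) (xcoin i≤R)
    ... | y-pos i i<R = subst (Coin R) (sym (g-y i (<⇒≤ i<R))) (ycoin (≤-trans (<⇒≤ i<R) (m≤n*m R 2)))
    ... | tail t      = subst (Coin R) (sym (g-tail t)) (ycoin (≤-trans (+-monoʳ-≤ R (tail-bound t k<n)) (≤-reflexive (cong (R +_) (sym (+-identityʳ R))))))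

    exchange-at : ∀ {k w C} → Position R k → k < 3 * suc R → Decomp R (g k + w) C →
                  (suc k < 3 * suc R → g k + w < g (suc k)) → Decomp< R w C
    exchange-at first _ dec below-next = exchange-unit R dec (below-next (<3[1+R] (s≤s z≤n)))
    exchange-at {w = w} {C} (x-pos i i≤R) _ dec below-next =
      exchange-x R i (subst (λ c → Decomp R (c + w) C) (g-x i i≤R) dec) w<a
      where
      w<a : w < a
      w<a = +-cancelˡ-< (g (1 + (i + i))) w a (subst (g (1 + (i + i)) + w <_) (g-step-odd i i≤R)
              (below-next (<3[1+R] (s≤s (s≤s (≤-trans (+-mono-≤ i≤R i≤R) (m≤m+n (R + R) R)))))))
    exchange-at {w = w} {C} (y-pos i i<R) _ dec below-next =
      exchange-y R i (subst (λ c → Decomp R (c + w) C) (g-y i (<⇒≤ i<R)) dec) (inj₂ (≤-<-trans (m≤m+n w a) w+a<M)) (inj₂ w+a<M)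
      where
      w<M∸a : w < M ∸ a
      w<M∸a = +-cancelˡ-< (g (2 + (i + i))) w (M ∸ a) (subst (g (2 + (i + i)) + w <_) (g-step-even i i<R)
                (below-next (<3[1+R] (s≤s (s≤s (≤-trans (+-mono-≤ i<R (<⇒≤ i<R)) (m≤m+n (R + R) R)))))))
      w+a<M : w + a < M
      w+a<M = subst (w + a <_) (m∸n+n≡m (<⇒≤ a<M)) (+-monoˡ-< a w<M∸a)
    exchange-at {w = w} {C} (tail t) k<n dec below-next =
      exchange-y R (R + t) (subst (λ c → Decomp R (c + w) C) (g-tail t) dec) last-or-w<M (inj₁ (m≤m+n R t))
      where
      last-or-w<M : R + t ≡ 2 * R ⊎ w < M
      last-or-w<M with 3 + (R + R + t) <? 3 * suc R
      ... | yes 1+k<n = inj₂ (+-cancelˡ-< (g (2 + (R + R + t))) w M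
                               (subst (g (2 + (R + R + t)) + w <_) (g-step-late t) (below-next 1+k<n)))
      ... | no  1+k≮n = inj₁ (cong (R +_) (trans t≡R (sym (+-identityʳ R))))
        where
        t≡R : t ≡ R
        t≡R = +-cancelˡ-≡ (R + R) t R (suc-injective (suc-injective (suc-injective
                (trans (≤∧≮⇒≡ k<n 1+k≮n) 3[1+R]≡))))

    exchange : ∀ {v C k} → Decomp R v C → Largest g (3 * suc R) v k → Decomp< R (v ∸ g k) C
    exchange {v} {C} {k} dec (k<n , gk≤v , above) =
      exchange-at (position R k) k<n (subst (λ v → Decomp R v C) (sym split) dec)
                  (λ 1+k<n → subst (_< g (suc k)) (sym split) (above (suc k) ≤-refl 1+k<n))
      where
      split : g k + (v ∸ g k) ≡ v
      split = m+[n∸m]≡n gk≤v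

    orderly-g : Orderly (applyUpTo g (3 * suc R))
    orderly-g = GreedyCriterion.orderly g (3 * suc R) (s≤s z≤n) refl (λ k _ → g>0 k) (Decomp R)
                  (rep⇒decomp R (applyUpTo⁺₁ g (3 * suc R) (g-coin _))) exchange

    private
      g2≡2a : g 2 ≡ 2 * a
      g2≡2a = trans (g-y 0 z≤n) (+-identityʳ (2 * a))

      M-not-coin : 1 ≤ R → ∀ l → g l ≢ M
      M-not-coin _   0                   1≡M  = <⇒≢ (<-trans 2≤a a<M) 1≡M
      M-not-coin _   1                   a≡M  = <⇒≢ a<M a≡M
      M-not-coin _   2                   g2≡M = M≢2a (trans (sym g2≡M) g2≡2a)
      M-not-coin 1≤R (suc (suc (suc l))) g≡M  = <⇒≱ M<g3 (subst (g 3 ≤_) g≡M (g-mono-≤ (s≤s (s≤s (s≤s z≤n)))))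
        where
        M<g3 : M < g 3
        M<g3 = subst (M <_) (sym (g-x 1 1≤R)) (subst (M <_) (cong (a +_) (sym (+-identityʳ M))) (m<n+m M (≤-trans (s≤s z≤n) 2≤a)))

    not-orderly-x : ∀ j → suc j ≤ R → ¬ Orderly (applyUpTo g (2 + (suc j + suc j)))
    not-orderly-x j 1+j≤R = not-orderly rep (subst (suc p <_) (sym greedy≡2+p) ≤-refl)
      where
      k n v : ℕ
      k = 1 + (suc j + suc j)
      n = suc k
      v = g k + (a + p)
      a+p<g : ∀ l → 1 < l → l < n → a + p < g l
      a+p<g l 1<l _ = <-≤-trans (subst (a + p <_) (trans (cong (a +_) (sym (+-identityʳ a))) (sym g2≡2a)) (+-monoʳ-< a p<a)) (g-mono-≤ 1<l)
      greedy≡2+p : grd (applyUpTo g n) v ≡ 2 + p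
      greedy≡2+p = begin
        grd (applyUpTo g n) v             ≡⟨ grd-applyUpTo g n v ⟩
        greedy g n v                      ≡⟨ greedy-top g k v (g>0 k) (m≤m+n (g k) (a + p)) ⟩
        suc (greedy g n (v ∸ g k))        ≡⟨ cong (λ w → suc (greedy g n w)) (m+n∸m≡n (g k) (a + p)) ⟩
        suc (greedy g n (a + p))          ≡⟨ cong suc (greedy-largest g n (a + p) 1 (g>0 1) (s≤s (s≤s z≤n) , m≤m+n a p , a+p<g)) ⟩
        2 + greedy g n (a + p ∸ a)        ≡⟨ cong (λ w → 2 + greedy g n w) (m+n∸m≡n a p) ⟩
        2 + greedy g n p                  ≡⟨ cong (2 +_) (greedy-units g n p (s≤s z≤n) refl (λ l 0<l _ → <-≤-trans p<a (g-mono-≤ 0<l))) ⟩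
        2 + p                             ∎
        where open ≡-Reasoning
      rep : Rep (applyUpTo g n) v (1 + p)
      rep = subst (λ v → Rep (applyUpTo g n) v (1 + p)) value
              (rep-+ (applyUpTo g n) (rep-coin (∈-applyUpTo⁺ g Yj<n))
                                     (rep-* (applyUpTo g n) p (rep-coin (∈-applyUpTo⁺ g (s≤s (s≤s (s≤s z≤n)))))))
        where
        Yj<n : 2 + (j + j) < n
        Yj<n = s≤s (s≤s (s≤s (+-monoʳ-≤ j (n≤1+n j))))
        value : g (2 + (j + j)) + p * g 2 ≡ v
        value = begin
          g (2 + (j + j)) + p * g 2         ≡⟨ cong₂ (λ x y → x + p * y) (g-y j (<⇒≤ 1+j≤R)) (g-y 0 z≤n) ⟩
          Y j + p * Y 0                     ≡⟨ Y+pY₀≡X+a+p j ⟩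
          X (suc j) + (a + p)               ≡⟨ cong (_+ (a + p)) (g-x (suc j) 1+j≤R) ⟨
          v                                 ∎
          where open ≡-Reasoning

    not-orderly-y : 1 ≤ R → ∀ {k J A B} → g k ≡ Y J → A ≤ R → B ≤ R → 1 + (A + A) < suc k → 1 + (B + B) < suc k →
                    A + B ≡ suc J → ¬ Orderly (applyUpTo g (suc k))
    not-orderly-y 1≤R {k} {J} {A} {B} gk≡YJ A≤R B≤R XA<n XB<n A+B≡1+J =
      not-orderly rep (subst (2 <_) (sym (grd-applyUpTo g (suc k) v)) greedy>2)
      where
      v : ℕ
      v = g k + M
      greedy>2 : 2 < greedy g (suc k) v
      greedy>2 = subst (2 <_) (sym (trans (greedy-top g k v (g>0 k) (m≤m+n (g k) M))
                                          (cong (λ w → suc (greedy g (suc k) w)) (m+n∸m≡n (g k) M))))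
                   (s≤s (greedy-non-coin g (suc k) M (s≤s z≤n) refl (λ l _ → g>0 l) (≤-<-trans z≤n a<M)
                                         (λ l _ → M-not-coin 1≤R l)))
      rep : Rep (applyUpTo g (suc k)) v 2
      rep = subst (λ v → Rep (applyUpTo g (suc k)) v 2) value
              (rep-+ (applyUpTo g (suc k)) (rep-coin (∈-applyUpTo⁺ g XA<n)) (rep-coin (∈-applyUpTo⁺ g XB<n)))
        where
        value : g (1 + (A + A)) + g (1 + (B + B)) ≡ v
        value = begin
          g (1 + (A + A)) + g (1 + (B + B))  ≡⟨ cong₂ _+_ (g-x A A≤R) (g-x B B≤R) ⟩
          X A + X B                          ≡⟨ X+X≡Y+M A B J A+B≡1+J ⟩
          Y J + M                            ≡⟨ cong (_+ M) gk≡YJ ⟨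
          v                                  ∎
          where open ≡-Reasoning

    not-orderly-g : 1 ≤ R → ∀ n → 4 ≤ n → n < 3 * suc R → ¬ Orderly (applyUpTo g n)
    not-orderly-g 1≤R (suc k) 4≤n n<N with position R k
    ... | first                = ⊥-elim (<⇒≱ (s≤s (s≤s z≤n)) 4≤n)
    ... | x-pos zero _         = ⊥-elim (<⇒≱ (s≤s (s≤s (s≤s z≤n))) 4≤n)
    ... | x-pos (suc j) 1+j≤R  = not-orderly-x j 1+j≤R
    ... | y-pos zero _         = ⊥-elim (<⇒≱ ≤-refl 4≤n)
    ... | y-pos (suc i) 1+i<R  =
      not-orderly-y 1≤R (g-y (suc i) (<⇒≤ 1+i<R)) 1≤R (<⇒≤ 1+i<R) (s≤s (s≤s (s≤s (s≤s z≤n)))) (n≤1+n _) refl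
    ... | tail t               =
      not-orderly-y 1≤R (g-tail t) ≤-refl 1+t≤R (s≤s (s≤s (≤-trans (m≤m+n (R + R) t) (n≤1+n _)))) XB<n (+-suc R t)
      where
      1+t≤R : suc t ≤ R
      1+t≤R = tail-bound (suc t) (subst (_< 3 * suc R) (cong (2 +_) (sym (+-suc (R + R) t))) n<N)
      XB<n : 1 + (suc t + suc t) < 3 + (R + R + t)
      XB<n = s≤s (s≤s (s≤s (subst (_≤ R + R + t) (+-comm (suc t) t) (+-monoˡ-≤ t (≤-trans 1+t≤R (m≤m+n R R))))))

  first-three : ∀ R → applyUpTo (g R) 3 ≡ applyUpTo (g 0) 3
  first-three R = cong (λ c → 1 ∷ a ∷ c ∷ []) (trans (g-y R 0 z≤n) (sym (g-y 0 0 z≤n)))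

theorem4p7 : ∀ (r m a : ℕ) → 2 ≤ r → 1 < m → m ≤ a →
    (∀ i → 1 ≤ i → i ≤ 3 → Orderly (take i (F r m a)))
    × (∀ i → 4 ≤ i → i < 3 * r → ¬ Orderly (take i (F r m a)))
    × Orderly (F r m a)
theorem4p7 r@(suc (suc R)) m a (s≤s (s≤s z≤n)) 1<m m≤a = short-prefixes , middle-prefixes , full
  where
  open Sequence m a 1<m m≤a
  F≡ : F r m a ≡ applyUpTo (g (suc R)) (3 * r)
  F≡ = map-upTo (g (suc R)) (3 * r)
  prefix : ∀ {i} → i ≤ 3 * r → take i (F r m a) ≡ applyUpTo (g (suc R)) i
  prefix i≤3r = trans (cong (take _) F≡) (take-applyUpTo (g (suc R)) i≤3r)
  3≤3r : 3 ≤ 3 * r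
  3≤3r = m≤m*n 3 r
  short-prefixes : ∀ i → 1 ≤ i → i ≤ 3 → Orderly (take i (F r m a))
  short-prefixes 1 _ i≤3 = subst Orderly (sym (prefix (≤-trans i≤3 3≤3r))) orderly-[1]
  short-prefixes 2 _ i≤3 = subst Orderly (sym (prefix (≤-trans i≤3 3≤3r))) (orderly-[1,c] a (≤-trans (s≤s z≤n) 2≤a))
  short-prefixes 3 _ i≤3 = subst Orderly (sym (trans (prefix 3≤3r) (first-three (suc R)))) (orderly-g 0)
  short-prefixes (suc (suc (suc (suc _)))) _ (s≤s (s≤s (s≤s ())))
  middle-prefixes : ∀ i → 4 ≤ i → i < 3 * r → ¬ Orderly (take i (F r m a))
  middle-prefixes i 4≤i i<3r = subst (λ cs → ¬ Orderly cs) (sym (prefix (<⇒≤ i<3r))) (not-orderly-g (suc R) (s≤s z≤n) i 4≤i i<3r)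
  full : Orderly (F r m a)
  full = subst Orderly (sym F≡) (orderly-g (suc R))
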